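{- Each of the following graphs contains a cycle whose length is divisible by $4$: (i) any graph $\Theta^e$, i.e. a graph consisting of three internally-disjoint paths from a vertex $x$ to a vertex $y\neq x$, all three of even length; (ii) any odd necklace $N^o$, i.e. a graph consisting of an adjustable $(x_1,x_2)$-path $R_1$, an adjustable $(x_2,x_3)$-path $R_2$ and an adjustable $(x_3,x_1)$-path $R_3$ (with $x_1,x_2,x_3$ distinct) such that $R_1,R_2,R_3$ are pairwise internally-disjoint (share no vertices other than common end-vertices); (iii) any graph $H_3^e$, $H_4^o$ or $H_4^e$, where for $k\in\{3,4\}$, $H_k^o$ (respectively $H_k^e$) denotes a subdivision of $K_4$ in which, for some $k$-cycle of the $K_4$, each edge of that $k$-cycle corresponds to a path of odd (respectively even) length.
   Context: All graphs are finite and simple; the length of a path or cycle is its number of edges, and a path or cycle is even/odd according to its length. An adjustable $(x,y)$-path is a graph consisting of an odd cycle $C$, a path $P_1$ from $x$ to a vertex of $C$ having no other vertex on $C$, and a path $P_2$ from a vertex of $C$ to $y$ having no other vertex on $C$, with $V(P_1)\cap V(P_2)=\emptyset$ ($P_1$ and/or $P_2$ may be trivial). In a subdivision of $K_4$, each edge of $K_4$ corresponds to a path, and these paths are internally-disjoint. -}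

module Defs where

open import Data.Nat using (ℕ; zero; suc; _+_; NonZero)
open import Data.Nat.DivMod using (_mod_)
open import Data.Nat.Divisibility using (_∣_)
open import Data.Fin using (Fin; zero; suc; inject₁; fromℕ; toℕ)
open import Data.Product using (Σ; ∃; _×_; _,_)
open import Data.Sum using (_⊎_)
open import Data.Empty using (⊥)
open import Relation.Nullary using (¬_)
open import Relation.Binary.PropositionalEquality using (_≡_; _≢_)

Even : ℕ → Set
Even L = 2 ∣ L

Odd : ℕ → Set
Odd L = ¬ (2 ∣ L)

record Graph : Set₁ where
  field
    n      : ℕ
    Adj    : Fin n → Fin n → Set
    sym    : ∀ {u v} → Adj u v → Adj v u
    irrefl : ∀ {u} → ¬ Adj u u

module _ (G : Graph) where
  open Graph G

  V : Set
  V = Fin n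

  record Path (L : ℕ) : Set where
    field
      vtx : Fin (suc L) → V
      inj : ∀ i j → vtx i ≡ vtx j → i ≡ j
      adj : ∀ (i : Fin L) → Adj (vtx (inject₁ i)) (vtx (suc i))

  start : ∀ {L} → Path L → V
  start P = Path.vtx P zero

  end : ∀ {L} → Path L → V
  end {L} P = Path.vtx P (fromℕ L)

  OnP : ∀ {L} → Path L → V → Set
  OnP P v = ∃ λ i → Path.vtx P i ≡ v

  EdgeP : ∀ {L} → Path L → V → V → Set
  EdgeP {L} P u v = ∃ λ (i : Fin L) →
      (Path.vtx P (inject₁ i) ≡ u × Path.vtx P (suc i) ≡ v)
    ⊎ (Path.vtx P (inject₁ i) ≡ v × Path.vtx P (suc i) ≡ u)

  IsEndP : ∀ {L} → Path L → V → Set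
  IsEndP P v = v ≡ start P ⊎ v ≡ end P

  IntDisjP : ∀ {L M} → Path L → Path M → Set
  IntDisjP P Q = ∀ v → OnP P v → OnP Q v → IsEndP P v × IsEndP Q v

  -- A cycle of length 3 + k: a path v0 … v(k+2) together with the edge v(k+2) v0.
  record Cycle : Set where
    field
      k     : ℕ
      path  : Path (suc (suc k))
      close : Adj (end path) (start path)

  cycleLength : Cycle → ℕ
  cycleLength C = 3 + Cycle.k C

  OnC : Cycle → V → Set
  OnC C v = OnP (Cycle.path C) v

  EdgeC : Cycle → V → V → Set
  EdgeC C u v = EdgeP (Cycle.path C) u v
              ⊎ (end (Cycle.path C) ≡ u × start (Cycle.path C) ≡ v)
              ⊎ (end (Cycle.path C) ≡ v × start (Cycle.path C) ≡ u)

  -- Adjustable (x,y)-path: odd cycle C, path P1 from x to a vertex of C with no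
  -- other vertex on C, path P2 from a vertex of C to y with no other vertex on C,
  -- V(P1) ∩ V(P2) = ∅ (P1, P2 possibly trivial).
  record Adjustable (x y : V) : Set where
    field
      C      : Cycle
      C-odd  : Odd (cycleLength C)
      l₁     : ℕ
      P₁     : Path l₁
      P₁-x   : start P₁ ≡ x
      P₁-C   : OnC C (end P₁)
      P₁-only : ∀ v → OnP P₁ v → OnC C v → v ≡ end P₁
      l₂     : ℕ
      P₂     : Path l₂
      P₂-y   : end P₂ ≡ y
      P₂-C   : OnC C (start P₂)
      P₂-only : ∀ v → OnP P₂ v → OnC C v → v ≡ start P₂
      P₁P₂-disj : ∀ v → OnP P₁ v → OnP P₂ v → ⊥

  OnA : ∀ {x y} → Adjustable x y → V → Set
  OnA R v = OnC (Adjustable.C R) v ⊎ OnP (Adjustable.P₁ R) v ⊎ OnP (Adjustable.P₂ R) v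

  EdgeA : ∀ {x y} → Adjustable x y → V → V → Set
  EdgeA R u v = EdgeC (Adjustable.C R) u v ⊎ EdgeP (Adjustable.P₁ R) u v
              ⊎ EdgeP (Adjustable.P₂ R) u v

  record ThetaE : Set where
    field
      x y    : V
      x≢y    : x ≢ y
      l₁ l₂ l₃ : ℕ
      P₁     : Path l₁
      P₂     : Path l₂
      P₃     : Path l₃
      starts : start P₁ ≡ x × start P₂ ≡ x × start P₃ ≡ x
      ends   : end P₁ ≡ y × end P₂ ≡ y × end P₃ ≡ y
      even   : Even l₁ × Even l₂ × Even l₃
      disj   : IntDisjP P₁ P₂ × IntDisjP P₂ P₃ × IntDisjP P₃ P₁
      coverV : ∀ v → OnP P₁ v ⊎ OnP P₂ v ⊎ OnP P₃ v
      coverE : ∀ u v → Adj u v → EdgeP P₁ u v ⊎ EdgeP P₂ u v ⊎ EdgeP P₃ u v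

  record OddNecklace : Set where
    field
      x₁ x₂ x₃ : V
      distinct : x₁ ≢ x₂ × x₂ ≢ x₃ × x₃ ≢ x₁
      R₁ : Adjustable x₁ x₂
      R₂ : Adjustable x₂ x₃
      R₃ : Adjustable x₃ x₁
      disj₁₂ : ∀ v → OnA R₁ v → OnA R₂ v → v ≡ x₂
      disj₂₃ : ∀ v → OnA R₂ v → OnA R₃ v → v ≡ x₃
      disj₃₁ : ∀ v → OnA R₃ v → OnA R₁ v → v ≡ x₁
      coverV : ∀ v → OnA R₁ v ⊎ OnA R₂ v ⊎ OnA R₃ v
      coverE : ∀ u v → Adj u v → EdgeA R₁ u v ⊎ EdgeA R₂ u v ⊎ EdgeA R₃ u v

-- Edges of K4 on vertex set Fin 4, numbered 0..5 as 01,02,03,12,13,23.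
K4src : Fin 6 → Fin 4
K4src zero = zero
K4src (suc zero) = zero
K4src (suc (suc zero)) = zero
K4src (suc (suc (suc zero))) = suc zero
K4src (suc (suc (suc (suc zero)))) = suc zero
K4src (suc (suc (suc (suc (suc zero))))) = suc (suc zero)

K4tgt : Fin 6 → Fin 4
K4tgt zero = suc zero
K4tgt (suc zero) = suc (suc zero)
K4tgt (suc (suc zero)) = suc (suc (suc zero))
K4tgt (suc (suc (suc zero))) = suc (suc zero)
K4tgt (suc (suc (suc (suc zero)))) = suc (suc (suc zero))
K4tgt (suc (suc (suc (suc (suc zero))))) = suc (suc (suc zero))

Joins : Fin 6 → Fin 4 → Fin 4 → Set
Joins e a b = (K4src e ≡ a × K4tgt e ≡ b) ⊎ (K4src e ≡ b × K4tgt e ≡ a)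

-- A k-cycle of K4: distinct K4-vertices c 0, …, c (k-1); its edges are
-- c i c (i+1 mod k).
record K4Cycle (k : ℕ) .{{_ : NonZero k}} : Set where
  field
    c   : Fin k → Fin 4
    inj : ∀ i j → c i ≡ c j → i ≡ j

nextK : (k : ℕ) .{{_ : NonZero k}} → Fin k → Fin k
nextK k i = (suc (toℕ i)) mod k

OnK4Cycle : ∀ {k} .{{_ : NonZero k}} → K4Cycle k → Fin 6 → Set
OnK4Cycle {k} Z e = ∃ λ i → Joins e (K4Cycle.c Z i) (K4Cycle.c Z (nextK k i))

module _ (G : Graph) where
  open Graph G

  record K4Subdivision : Set where
    field
      b      : Fin 4 → V G
      b-inj  : ∀ i j → b i ≡ b j → i ≡ j
      len    : Fin 6 → ℕ
      P      : (e : Fin 6) → Path G (len e)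
      P-start : ∀ e → start G (P e) ≡ b (K4src e)
      P-end   : ∀ e → end G (P e) ≡ b (K4tgt e)
      disj   : ∀ e e' → e ≢ e' → IntDisjP G (P e) (P e')
      coverV : ∀ v → ∃ λ e → OnP G (P e) v
      coverE : ∀ u v → Adj u v → ∃ λ e → EdgeP G (P e) u v

  H : (k : ℕ) .{{_ : NonZero k}} → (ℕ → Set) → Set
  H k Par = Σ K4Subdivision λ S → Σ (K4Cycle k) λ Z →
              ∀ e → OnK4Cycle Z e → Par (K4Subdivision.len S e)

  H3e H4o H4e : Set
  H3e = H 3 Even
  H4o = H 4 Odd
  H4e = H 4 Even

  HasCycle4 : Set
  HasCycle4 = Σ (Cycle G) λ C → 4 ∣ cycleLength G C

-- A cycle of length divisible by 4 is found among a few explicit cycles whose lengths are sums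
-- of lengths of paths the structure provides; since divisibility by 4 and parity depend only on
-- residues mod 4, which of those sums is divisible is settled by a finite check over residues.
-- In Θ^e the three cycles are the unions of two of the even x–y paths. An adjustable (x,y)-path
-- contains x–y paths of both parities (going either way round its odd cycle), so an odd necklace
-- gives four cycles, one through each choice of an even number of the odd paths. A subdivision
-- of K4 gives one cycle for each of the seven cycles of K4.

module Submission where

open import Defs
open import Data.Empty using (⊥; ⊥-elim)
open import Data.Fin using (Fin; zero; suc; inject₁; fromℕ; _≟_)
open import Data.Fin.Properties using (all?; any?)
open import Data.List as List using (List; []; _∷_; _++_; _∷ʳ_; map)
import Data.List.Properties as Listₚ
open import Data.List.Membership.Propositional using (_∈_; _∉_)
open import Data.List.Membership.Propositional.Properties
  using (∈-++⁻; ∈-++⁺ˡ; ∈-++⁺ʳ; ∈-lookup; ∈-tabulate⁺; ∈-tabulate⁻)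
open import Data.List.Relation.Binary.Disjoint.Propositional using (Disjoint)
open import Data.List.Relation.Unary.All as All using (All; []; _∷_; lookupAny)
open import Data.List.Relation.Unary.All.Properties using (All¬⇒¬Any; ¬Any⇒All¬; ++⁻ˡ; ++⁻ʳ)
open import Data.List.Relation.Unary.AllPairs using (tail)
open import Data.List.Relation.Unary.Any as Any using (Any; here; there)
open import Data.List.Relation.Unary.Any.Properties using (map⁻)
open import Data.List.Relation.Unary.Unique.Propositional using (Unique; []; _∷_)
open import Data.List.Relation.Unary.Unique.Propositional.Properties using (++⁺; tabulate⁺)
open import Data.Nat using (ℕ; zero; suc; _+_; _*_; _%_; _<_; _≤_; s≤s; z≤n; NonZero; >-nonZero)
open import Data.Nat.DivMod using (%-distribˡ-+; m%n%n≡m%n; m%n<n)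
open import Data.Nat.Divisibility
  using (_∣_; _∣?_; divides; m%n≡0⇒n∣m; n∣m⇒m%n≡0; ∣n∣m%n⇒∣m; %-presˡ-∣; ∣m+n∣m⇒∣n; ∣⇒≤)
open import Data.Nat.ListAction using (sum)
open import Data.Nat.Properties using (allUpTo?; suc-injective; +-mono-≤; +-assoc; +-identityʳ)
open import Data.Nat.Tactic.RingSolver using (solve-∀)
open import Data.Product using (Σ; ∃; _×_; _,_; proj₁; proj₂)
import Data.Product as Product
open import Data.Sum using (_⊎_; inj₁; inj₂; [_,_]′)
import Data.Sum as Sum
open import Function using (_∘_; _⇔_; mk⇔; Equivalence)
open import Relation.Binary.PropositionalEquality
open import Relation.Binary.PropositionalEquality.Properties using (setoid)
open import Relation.Nullary using (¬?)
open import Relation.Nullary.Decidable using (Dec; from-yes; _→-dec_; _×-dec_; _⊎-dec_)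
open import Relation.Unary using (_∪_)

-- Residues modulo 4

SomeDivisible : List (List ℕ) → Set
SomeDivisible = Any (λ xs → 4 ∣ sum xs)

sum-map-% : ∀ d .{{_ : NonZero d}} xs → sum (map (_% d) xs) % d ≡ sum xs % d
sum-map-% d [] = refl
sum-map-% d (x ∷ xs) = begin
  (x % d + sum (map (_% d) xs)) % d          ≡⟨ %-distribˡ-+ (x % d) _ d ⟩
  (x % d % d + sum (map (_% d) xs) % d) % d  ≡⟨ cong₂ (λ u v → (u + v) % d) (m%n%n≡m%n x d) (sum-map-% d xs) ⟩
  (x % d + sum xs % d) % d                   ≡⟨ %-distribˡ-+ x (sum xs) d ⟨
  (x + sum xs) % d                           ∎
  where open ≡-Reasoning

∣sum-map-% : ∀ {d} .{{_ : NonZero d}} xs → d ∣ sum (map (_% d) xs) → d ∣ sum xs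
∣sum-map-% {d} xs d∣ = m%n≡0⇒n∣m (sum xs) d (trans (sym (sum-map-% d xs)) (n∣m⇒m%n≡0 _ d d∣))

someDivisible-% : ∀ xss → SomeDivisible (map (map (_% 4)) xss) → SomeDivisible xss
someDivisible-% xss h = Any.map (λ {xs} → ∣sum-map-% xs) (map⁻ h)

even-% : ∀ {n} → Even n → Even (n % 4)
even-% e = %-presˡ-∣ e (divides 2 refl)

odd-% : ∀ {n} → Odd n → Odd (n % 4)
odd-% o e = o (∣n∣m%n⇒∣m (divides 2 refl) e)

even-%⁻ : ∀ {n} → Even (n % 4) → Even n
even-%⁻ = ∣n∣m%n⇒∣m (divides 2 refl)

odd-%⁻ : ∀ {n} → Odd (n % 4) → Odd n
odd-%⁻ o e = o (even-% e)

even⇒2≤ : ∀ {n} → Even n → 0 < n → 2 ≤ n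
even⇒2≤ e 0<n = ∣⇒≤ {{>-nonZero 0<n}} e

odd-+-shift : ∀ {a a′} l r → Odd (a + a′) → Odd ((l + (a + r)) + (l + (a′ + r)))
odd-+-shift {a} {a′} l r odd even =
  odd (∣m+n∣m⇒∣n (subst (2 ∣_) (regroup a a′ l r) even) (divides (l + r) refl))
  where
  regroup : ∀ a a′ l r → (l + (a + r)) + (l + (a′ + r)) ≡ (l + r) * 2 + (a + a′)
  regroup = solve-∀

thetaSums : ℕ → ℕ → ℕ → List (List ℕ)
thetaSums a b c = (a ∷ b ∷ []) ∷ (b ∷ c ∷ []) ∷ (c ∷ a ∷ []) ∷ []

necklaceSums : (e₁ o₁ e₂ o₂ e₃ o₃ : ℕ) → List (List ℕ)
necklaceSums e₁ o₁ e₂ o₂ e₃ o₃ =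
  (e₁ ∷ e₂ ∷ e₃ ∷ []) ∷ (e₁ ∷ o₂ ∷ o₃ ∷ []) ∷ (o₁ ∷ e₂ ∷ o₃ ∷ []) ∷ (o₁ ∷ o₂ ∷ e₃ ∷ []) ∷ []

k4Sums : (ab ac ad bc bd cd : ℕ) → List (List ℕ)
k4Sums ab ac ad bc bd cd =
  (ab ∷ bc ∷ ac ∷ []) ∷ (ab ∷ bd ∷ ad ∷ []) ∷ (ac ∷ cd ∷ ad ∷ []) ∷ (bc ∷ cd ∷ bd ∷ []) ∷
  (ab ∷ bc ∷ cd ∷ ad ∷ []) ∷ (ab ∷ bd ∷ cd ∷ ac ∷ []) ∷ (ac ∷ bc ∷ bd ∷ ad ∷ []) ∷ []

private
  odd? : ∀ n → Dec (Odd n)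
  odd? n = ¬? (2 ∣? n)

  someDivisible? : ∀ xss → Dec (SomeDivisible xss)
  someDivisible? = Any.any? (λ xs → 4 ∣? sum xs)

  <4 : ∀ n → n % 4 < 4
  <4 n = m%n<n n 4

  parities-residues : ∀ {m} → m < 4 → ∀ {n} → n < 4 →
                      Odd (m + n) → Even m × Odd n ⊎ Odd m × Even n
  parities-residues = from-yes (allUpTo? (λ m → allUpTo? (λ n →
    odd? (m + n) →-dec ((2 ∣? m ×-dec odd? n) ⊎-dec (odd? m ×-dec 2 ∣? n))) 4) 4)

  theta-residues : ∀ {a} → a < 4 → ∀ {b} → b < 4 → ∀ {c} → c < 4 →
                   Even a → Even b → Even c → SomeDivisible (thetaSums a b c)
  theta-residues = from-yes (allUpTo? (λ a → allUpTo? (λ b → allUpTo? (λ c →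
    2 ∣? a →-dec 2 ∣? b →-dec 2 ∣? c →-dec someDivisible? (thetaSums a b c)) 4) 4) 4)

  necklace-residues : ∀ {e₁} → e₁ < 4 → ∀ {o₁} → o₁ < 4 → ∀ {e₂} → e₂ < 4 → ∀ {o₂} → o₂ < 4 →
                      ∀ {e₃} → e₃ < 4 → ∀ {o₃} → o₃ < 4 →
                      Even e₁ → Odd o₁ → Even e₂ → Odd o₂ → Even e₃ → Odd o₃ →
                      SomeDivisible (necklaceSums e₁ o₁ e₂ o₂ e₃ o₃)
  necklace-residues = from-yes (allUpTo? (λ e₁ → allUpTo? (λ o₁ → allUpTo? (λ e₂ → allUpTo? (λ o₂ →
    allUpTo? (λ e₃ → allUpTo? (λ o₃ →
      2 ∣? e₁ →-dec odd? o₁ →-dec 2 ∣? e₂ →-dec odd? o₂ →-dec 2 ∣? e₃ →-dec odd? o₃ →-dec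
      someDivisible? (necklaceSums e₁ o₁ e₂ o₂ e₃ o₃)) 4) 4) 4) 4) 4) 4)

  K4Conditions : (ab ac ad bc bd cd : ℕ) → Set
  K4Conditions ab ac ad bc bd cd =
    (Even ab → Even bc → Even ac → SomeDivisible (k4Sums ab ac ad bc bd cd)) ×
    (Odd ab → Odd bc → Odd cd → Odd ad → SomeDivisible (k4Sums ab ac ad bc bd cd)) ×
    (Even ab → Even bc → Even cd → Even ad → SomeDivisible (k4Sums ab ac ad bc bd cd))

  k4-residues : ∀ {ab} → ab < 4 → ∀ {ac} → ac < 4 → ∀ {ad} → ad < 4 → ∀ {bc} → bc < 4 →
                ∀ {bd} → bd < 4 → ∀ {cd} → cd < 4 → K4Conditions ab ac ad bc bd cd
  k4-residues = from-yes (allUpTo? (λ ab → allUpTo? (λ ac → allUpTo? (λ ad → allUpTo? (λ bc →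
    allUpTo? (λ bd → allUpTo? (λ cd → let sums? = someDivisible? (k4Sums ab ac ad bc bd cd) in
      (2 ∣? ab →-dec 2 ∣? bc →-dec 2 ∣? ac →-dec sums?) ×-dec
      (odd? ab →-dec odd? bc →-dec odd? cd →-dec odd? ad →-dec sums?) ×-dec
      (2 ∣? ab →-dec 2 ∣? bc →-dec 2 ∣? cd →-dec 2 ∣? ad →-dec sums?)) 4) 4) 4) 4) 4) 4)

  k4-conditions : ∀ ab ac ad bc bd cd → K4Conditions (ab % 4) (ac % 4) (ad % 4) (bc % 4) (bd % 4) (cd % 4)
  k4-conditions ab ac ad bc bd cd = k4-residues (<4 ab) (<4 ac) (<4 ad) (<4 bc) (<4 bd) (<4 cd)

odd-+-parities : ∀ {m n} → Odd (m + n) → Even m × Odd n ⊎ Odd m × Even n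
odd-+-parities {m} {n} odd =
  Sum.map (Product.map even-%⁻ odd-%⁻) (Product.map odd-%⁻ even-%⁻)
    (parities-residues (<4 m) (<4 n) (odd-%⁻ (subst Odd (%-distribˡ-+ m n 4) (odd-% odd))))

theta-divisible : ∀ {a b c} → Even a → Even b → Even c → SomeDivisible (thetaSums a b c)
theta-divisible {a} {b} {c} ea eb ec = someDivisible-% (thetaSums a b c)
  (theta-residues (<4 a) (<4 b) (<4 c) (even-% ea) (even-% eb) (even-% ec))

necklace-divisible : ∀ {e₁ o₁ e₂ o₂ e₃ o₃} → Even e₁ → Odd o₁ → Even e₂ → Odd o₂ → Even e₃ → Odd o₃ →
                     SomeDivisible (necklaceSums e₁ o₁ e₂ o₂ e₃ o₃)
necklace-divisible {e₁} {o₁} {e₂} {o₂} {e₃} {o₃} ee₁ oo₁ ee₂ oo₂ ee₃ oo₃ =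
  someDivisible-% (necklaceSums e₁ o₁ e₂ o₂ e₃ o₃)
    (necklace-residues (<4 e₁) (<4 o₁) (<4 e₂) (<4 o₂) (<4 e₃) (<4 o₃)
      (even-% ee₁) (odd-% oo₁) (even-% ee₂) (odd-% oo₂) (even-% ee₃) (odd-% oo₃))

k4-even-triangle : ∀ {ab ac ad bc bd cd} → Even ab → Even bc → Even ac →
                   SomeDivisible (k4Sums ab ac ad bc bd cd)
k4-even-triangle {ab} {ac} {ad} {bc} {bd} {cd} eab ebc eac = someDivisible-% (k4Sums ab ac ad bc bd cd)
  (proj₁ (k4-conditions ab ac ad bc bd cd) (even-% eab) (even-% ebc) (even-% eac))

k4-odd-square : ∀ {ab ac ad bc bd cd} → Odd ab → Odd bc → Odd cd → Odd ad →
                SomeDivisible (k4Sums ab ac ad bc bd cd)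
k4-odd-square {ab} {ac} {ad} {bc} {bd} {cd} oab obc ocd oad = someDivisible-% (k4Sums ab ac ad bc bd cd)
  (proj₁ (proj₂ (k4-conditions ab ac ad bc bd cd)) (odd-% oab) (odd-% obc) (odd-% ocd) (odd-% oad))

k4-even-square : ∀ {ab ac ad bc bd cd} → Even ab → Even bc → Even cd → Even ad →
                 SomeDivisible (k4Sums ab ac ad bc bd cd)
k4-even-square {ab} {ac} {ad} {bc} {bd} {cd} eab ebc ecd ead = someDivisible-% (k4Sums ab ac ad bc bd cd)
  (proj₂ (proj₂ (k4-conditions ab ac ad bc bd cd)) (even-% eab) (even-% ebc) (even-% ecd) (even-% ead))

module _ {A : Set} where

  Unique-++⁻ : ∀ (xs : List A) {ys} → Unique (xs ++ ys) → Unique xs × Unique ys × Disjoint xs ys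
  Unique-++⁻ [] u = [] , u , λ { (() , _) }
  Unique-++⁻ (x ∷ xs) (x∉ ∷ u) with Unique-++⁻ xs u
  ... | xs-unique , ys-unique , disjoint = ++⁻ˡ xs x∉ ∷ xs-unique , ys-unique , λ where
    (here refl , h) → All¬⇒¬Any (++⁻ʳ xs x∉) h
    (there h′ , h) → disjoint (h′ , h)

  lookup-injective : ∀ {xs : List A} → Unique xs → ∀ i j → List.lookup xs i ≡ List.lookup xs j → i ≡ j
  lookup-injective (_ ∷ _) zero zero _ = refl
  lookup-injective (x∉ ∷ _) zero (suc j) eq = ⊥-elim (All.lookup x∉ (∈-lookup j) eq)
  lookup-injective (x∉ ∷ _) (suc i) zero eq = ⊥-elim (All.lookup x∉ (∈-lookup i) (sym eq))
  lookup-injective (_ ∷ u) (suc i) (suc j) eq = cong suc (lookup-injective u i j eq)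

-- The combinatorics of K4

IsEnd : Fin 6 → Fin 4 → Set
IsEnd e t = t ≡ K4src e ⊎ t ≡ K4tgt e

module _ {e : Fin 6} {p q : Fin 4} where

  joins-sym : Joins e p q → Joins e q p
  joins-sym = Sum.swap

  joins-endˡ : Joins e p q → IsEnd e p
  joins-endˡ (inj₁ (refl , _)) = inj₁ refl
  joins-endˡ (inj₂ (_ , refl)) = inj₂ refl

  joins-ends : ∀ {t} → Joins e p q → IsEnd e t → t ≡ p ⊎ t ≡ q
  joins-ends (inj₁ (refl , refl)) t-end = t-end
  joins-ends (inj₂ (refl , refl)) t-end = Sum.swap t-end

joins-≢ : ∀ {e e′ p q r s} → Joins e p q → Joins e′ r s → p ≢ r → p ≢ s → e ≢ e′
joins-≢ j j′ p≢r p≢s refl = [ p≢r , p≢s ]′ (joins-ends j′ (joins-endˡ j))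

-- Abstract, so that unification never unfolds the decision procedures.
abstract
  private
    k4-edge : ∀ p q → p ≢ q → ∃ λ e → Joins e p q
    k4-edge = from-yes (all? λ (p : Fin 4) → all? λ (q : Fin 4) → ¬? (p ≟ q) →-dec any? λ (e : Fin 6) →
      (K4src e ≟ p ×-dec K4tgt e ≟ q) ⊎-dec (K4src e ≟ q ×-dec K4tgt e ≟ p))

  edge : ∀ (p q : Fin 4) → p ≢ q → Fin 6
  edge p q p≢q = proj₁ (k4-edge p q p≢q)

  edge-joins : ∀ (p q : Fin 4) (p≢q : p ≢ q) → Joins (edge p q p≢q) p q
  edge-joins p q p≢q = proj₂ (k4-edge p q p≢q)

  fourth-vertex : ∀ (a b c : Fin 4) → ∃ λ d → a ≢ d × b ≢ d × c ≢ d
  fourth-vertex = from-yes (all? λ (a : Fin 4) → all? λ (b : Fin 4) → all? λ (c : Fin 4) → any? λ (d : Fin 4) →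
    ¬? (a ≟ d) ×-dec ¬? (b ≟ d) ×-dec ¬? (c ≟ d))

record K4Frame : Set where
  field
    a b c d : Fin 4
    a≢b : a ≢ b
    a≢c : a ≢ c
    a≢d : a ≢ d
    b≢c : b ≢ c
    b≢d : b ≢ d
    c≢d : c ≢ d

  ab ac ad bc bd cd : Fin 6
  ab = edge a b a≢b
  ac = edge a c a≢c
  ad = edge a d a≢d
  bc = edge b c b≢c
  bd = edge b d b≢d
  cd = edge c d c≢d

  ab-joins : Joins ab a b
  ab-joins = edge-joins a b a≢b
  ac-joins : Joins ac a c
  ac-joins = edge-joins a c a≢c
  ad-joins : Joins ad a d
  ad-joins = edge-joins a d a≢d
  bc-joins : Joins bc b c
  bc-joins = edge-joins b c b≢c
  bd-joins : Joins bd b d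
  bd-joins = edge-joins b d b≢d
  cd-joins : Joins cd c d
  cd-joins = edge-joins c d c≢d

corners-distinct : ∀ {k} .{{_ : NonZero k}} (Z : K4Cycle k) {i j} → i ≢ j → K4Cycle.c Z i ≢ K4Cycle.c Z j
corners-distinct Z i≢j = i≢j ∘ K4Cycle.inj Z _ _

triangleFrame : K4Cycle 3 → K4Frame
triangleFrame Z = record
  { a = corner zero ; b = corner (suc zero) ; c = corner (suc (suc zero)) ; d = proj₁ fourth
  ; a≢b = corners-distinct Z (λ ()) ; a≢c = corners-distinct Z (λ ()) ; b≢c = corners-distinct Z (λ ())
  ; a≢d = proj₁ (proj₂ fourth) ; b≢d = proj₁ (proj₂ (proj₂ fourth)) ; c≢d = proj₂ (proj₂ (proj₂ fourth)) }
  where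
  corner = K4Cycle.c Z
  fourth : ∃ λ d → corner zero ≢ d × corner (suc zero) ≢ d × corner (suc (suc zero)) ≢ d
  fourth = fourth-vertex (corner zero) (corner (suc zero)) (corner (suc (suc zero)))

squareFrame : K4Cycle 4 → K4Frame
squareFrame Z = record
  { a = corner zero ; b = corner (suc zero) ; c = corner (suc (suc zero)) ; d = corner (suc (suc (suc zero)))
  ; a≢b = corners-distinct Z (λ ()) ; a≢c = corners-distinct Z (λ ()) ; a≢d = corners-distinct Z (λ ())
  ; b≢c = corners-distinct Z (λ ()) ; b≢d = corners-distinct Z (λ ()) ; c≢d = corners-distinct Z (λ ()) }
  where
  corner = K4Cycle.c Z

-- Walks, paths and cycles

module Walks (G : Graph) where
  open Graph G using (Adj) renaming (sym to Adj-sym)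
  open import Data.List.Relation.Binary.Permutation.Setoid (setoid (V G)) using (_↭_; ↭-sym)
  open import Data.List.Relation.Binary.Permutation.Setoid.Properties (setoid (V G))
    using (Unique-resp-↭; ∈-resp-↭; ↭-reverse; ++-comm; xs↭ys⇒|xs|≡|ys|)

  infixr 5 _◅_ _◅◅_
  infix 4 _∈ʷ_

  data Walk : V G → V G → Set where
    [_] : ∀ v → Walk v v
    _◅_ : ∀ {u v w} → Adj u v → Walk v w → Walk u w

  private variable a b c : V G

  vertices⁺ : Walk a b → List (V G)
  vertices⁺ [ _ ] = []
  vertices⁺ (_◅_ {v = v} _ w) = v ∷ vertices⁺ w

  vertices : Walk a b → List (V G)
  vertices {a} w = a ∷ vertices⁺ w

  length : Walk a b → ℕ
  length w = List.length (vertices⁺ w)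

  _∈ʷ_ : V G → Walk a b → Set
  v ∈ʷ w = v ∈ vertices w

  IsPath : Walk a b → Set
  IsPath w = Unique (vertices w)

  _◅◅_ : Walk a b → Walk b c → Walk a c
  [ _ ] ◅◅ q = q
  (e ◅ p) ◅◅ q = e ◅ (p ◅◅ q)

  reverse : Walk a b → Walk b a
  reverse [ v ] = [ v ]
  reverse (_◅_ {u} e p) = reverse p ◅◅ (Adj-sym e ◅ [ u ])

  vertices⁺-◅◅ : (p : Walk a b) (q : Walk b c) → vertices⁺ (p ◅◅ q) ≡ vertices⁺ p ++ vertices⁺ q
  vertices⁺-◅◅ [ _ ] q = refl
  vertices⁺-◅◅ (_◅_ {v = v} e p) q = cong (v ∷_) (vertices⁺-◅◅ p q)

  vertices-◅◅ : (p : Walk a b) (q : Walk b c) → vertices (p ◅◅ q) ≡ vertices p ++ vertices⁺ q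
  vertices-◅◅ {a} p q = cong (a ∷_) (vertices⁺-◅◅ p q)

  length-◅◅ : (p : Walk a b) (q : Walk b c) → length (p ◅◅ q) ≡ length p + length q
  length-◅◅ p q = trans (cong List.length (vertices⁺-◅◅ p q)) (Listₚ.length-++ (vertices⁺ p))

  vertices-reverse : (p : Walk a b) → vertices (reverse p) ≡ List.reverse (vertices p)
  vertices-reverse [ v ] = refl
  vertices-reverse (_◅_ {u} e p) = begin
    vertices (reverse p ◅◅ (Adj-sym e ◅ [ u ])) ≡⟨ vertices-◅◅ (reverse p) _ ⟩
    vertices (reverse p) ∷ʳ u                   ≡⟨ cong (_∷ʳ u) (vertices-reverse p) ⟩
    List.reverse (vertices p) ∷ʳ u              ≡⟨ Listₚ.unfold-reverse u (vertices p) ⟨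
    List.reverse (u ∷ vertices p)               ∎
    where open ≡-Reasoning

  length-reverse : (p : Walk a b) → length (reverse p) ≡ length p
  length-reverse p = suc-injective (begin
    List.length (vertices (reverse p))        ≡⟨ cong List.length (vertices-reverse p) ⟩
    List.length (List.reverse (vertices p))   ≡⟨ Listₚ.length-reverse (vertices p) ⟩
    List.length (vertices p)                  ∎)
    where open ≡-Reasoning

  ≢⇒0<length : a ≢ b → (w : Walk a b) → 0 < length w
  ≢⇒0<length a≢b [ _ ] = ⊥-elim (a≢b refl)
  ≢⇒0<length _ (_ ◅ _) = s≤s z≤n

  end-∈ : (w : Walk a b) → b ∈ʷ w
  end-∈ [ _ ] = here refl
  end-∈ (_ ◅ w) = there (end-∈ w)

  end-∈⁺ : a ≢ b → (w : Walk a b) → b ∈ vertices⁺ w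
  end-∈⁺ a≢b [ _ ] = ⊥-elim (a≢b refl)
  end-∈⁺ a≢b (_ ◅ w) = end-∈ w

  ∈-◅◅⁻ : (p : Walk a b) (q : Walk b c) → ∀ {v} → v ∈ʷ p ◅◅ q → v ∈ʷ p ⊎ v ∈ʷ q
  ∈-◅◅⁻ p q {v} h with ∈-++⁻ (vertices p) (subst (v ∈_) (vertices-◅◅ p q) h)
  ... | inj₁ h₁ = inj₁ h₁
  ... | inj₂ h₂ = inj₂ (there h₂)

  ∈-reverse⁻ : (p : Walk a b) → ∀ {v} → v ∈ʷ reverse p → v ∈ʷ p
  ∈-reverse⁻ p {v} h = ∈-resp-↭ (↭-reverse (vertices p)) (subst (v ∈_) (vertices-reverse p) h)

  ∈-split : (w : Walk a b) → ∀ {v} → v ∈ʷ w → Σ (Walk a v) λ p → Σ (Walk v b) λ q → p ◅◅ q ≡ w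
  ∈-split [ _ ] (here refl) = [ _ ] , [ _ ] , refl
  ∈-split (e ◅ w) (here refl) = [ _ ] , e ◅ w , refl
  ∈-split (e ◅ w) (there h) with p , q , refl ← ∈-split w h = e ◅ p , q , refl

  start-∉ : (w : Walk a b) → IsPath w → a ∉ vertices⁺ w
  start-∉ w (a∉ ∷ _) = All¬⇒¬Any a∉

  ◅◅-isPath : (p : Walk a b) (q : Walk b c) → IsPath p → IsPath q →
              (∀ {v} → v ∈ʷ p → v ∈ʷ q → v ≡ b) → IsPath (p ◅◅ q)
  ◅◅-isPath p q p-path q-path meet =
    subst Unique (sym (vertices-◅◅ p q)) (++⁺ p-path (tail q-path) disjoint)
    where
    disjoint : Disjoint (vertices p) (vertices⁺ q)
    disjoint (h , h⁺) = start-∉ q q-path (subst (_∈ vertices⁺ q) (meet h (there h⁺)) h⁺)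

  reverse-isPath : (p : Walk a b) → IsPath p → IsPath (reverse p)
  reverse-isPath p p-path =
    subst Unique (sym (vertices-reverse p)) (Unique-resp-↭ (↭-sym (↭-reverse (vertices p))) p-path)

  record PathIn (U : V G → Set) (x y : V G) : Set where
    field
      walk   : Walk x y
      isPath : IsPath walk
      within : ∀ {v} → v ∈ʷ walk → U v

  open PathIn public

  pathLength : ∀ {U x y} → PathIn U x y → ℕ
  pathLength P = length (walk P)

  weaken : ∀ {U U′ x y} → (∀ {v} → U v → U′ v) → PathIn U x y → PathIn U′ x y
  weaken U⊆U′ P = record { walk = walk P ; isPath = isPath P ; within = U⊆U′ ∘ within P }

  reversePathIn : ∀ {U x y} → PathIn U x y → PathIn U y x
  reversePathIn P = record
    { walk = reverse (walk P) ; isPath = reverse-isPath (walk P) (isPath P)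
    ; within = within P ∘ ∈-reverse⁻ (walk P) }

  pathLength-reverse : ∀ {U x y} (P : PathIn U x y) → pathLength (reversePathIn P) ≡ pathLength P
  pathLength-reverse P = length-reverse (walk P)

  join : ∀ {U U′ x y z} (P : PathIn U x y) (Q : PathIn U′ y z) →
         (∀ {v} → U v → U′ v → v ≡ y) → PathIn (U ∪ U′) x z
  join P Q meet = record
    { walk = walk P ◅◅ walk Q
    ; isPath = ◅◅-isPath (walk P) (walk Q) (isPath P) (isPath Q) (λ h h′ → meet (within P h) (within Q h′))
    ; within = Sum.map (within P) (within Q) ∘ ∈-◅◅⁻ (walk P) (walk Q) }

  module _ {U U′ x y z} (P : PathIn U x y) (Q : PathIn U′ y z) (meet : ∀ {v} → U v → U′ v → v ≡ y) where

    pathLength-join : pathLength (join P Q meet) ≡ pathLength P + pathLength Q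
    pathLength-join = length-◅◅ (walk P) (walk Q)

    2≤pathLength-join : x ≢ y → y ≢ z → 2 ≤ pathLength (join P Q meet)
    2≤pathLength-join x≢y y≢z = subst (2 ≤_) (sym pathLength-join)
      (+-mono-≤ (≢⇒0<length x≢y (walk P)) (≢⇒0<length y≢z (walk Q)))

  -- The repeated end vertex of a closed walk is counted once.
  IsCycle : Walk c c → Set
  IsCycle W = Unique (vertices⁺ W)

  rotate : (W : Walk a a) → c ∈ vertices⁺ W → Σ (Walk c c) λ W′ → vertices⁺ W′ ↭ vertices⁺ W
  rotate W c∈W with X , Y , refl ← ∈-split W (there c∈W) =
    Y ◅◅ X , subst₂ _↭_ (sym (vertices⁺-◅◅ Y X)) (sym (vertices⁺-◅◅ X Y)) (++-comm (vertices⁺ Y) (vertices⁺ X))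

  split-cycle : (W : Walk c c) → IsCycle W → ∀ {d} → d ∈ vertices⁺ W → c ≢ d →
                Σ (PathIn (_∈ vertices⁺ W) c d) λ A → Σ (PathIn (_∈ vertices⁺ W) d c) λ B →
                pathLength A + pathLength B ≡ length W
  split-cycle W W-cycle d∈W c≢d with X , Y , refl ← ∈-split W (there d∈W)
    with X⁺-unique , Y⁺-unique , disjoint ← Unique-++⁻ (vertices⁺ X) (subst Unique (vertices⁺-◅◅ X Y) W-cycle) =
    record { walk = X ; isPath = ¬Any⇒All¬ _ (λ h → disjoint (h , c∈Y⁺)) ∷ X⁺-unique ; within = X-within } ,
    record { walk = Y ; isPath = ¬Any⇒All¬ _ (λ h → disjoint (d∈X⁺ , h)) ∷ Y⁺-unique ; within = Y-within } ,
    sym (length-◅◅ X Y)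
    where
    c∈Y⁺ = end-∈⁺ (c≢d ∘ sym) Y
    d∈X⁺ = end-∈⁺ c≢d X
    in-W : ∀ {v} → v ∈ vertices⁺ X ++ vertices⁺ Y → v ∈ vertices⁺ (X ◅◅ Y)
    in-W = subst (_ ∈_) (sym (vertices⁺-◅◅ X Y))
    X-within : ∀ {v} → v ∈ʷ X → v ∈ vertices⁺ (X ◅◅ Y)
    X-within (here refl) = in-W (∈-++⁺ʳ (vertices⁺ X) c∈Y⁺)
    X-within (there h) = in-W (∈-++⁺ˡ h)
    Y-within : ∀ {v} → v ∈ʷ Y → v ∈ vertices⁺ (X ◅◅ Y)
    Y-within (here refl) = in-W (∈-++⁺ˡ d∈X⁺)
    Y-within (there h) = in-W (∈-++⁺ʳ (vertices⁺ X) h)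

  private
    walkOf′ : ∀ L (f : Fin (suc L) → V G) → (∀ i → Adj (f (inject₁ i)) (f (suc i))) → Walk (f zero) (f (fromℕ L))
    walkOf′ zero f adj = [ f zero ]
    walkOf′ (suc L) f adj = adj zero ◅ walkOf′ L (f ∘ suc) (adj ∘ suc)

    vertices-walkOf′ : ∀ L f adj → vertices (walkOf′ L f adj) ≡ List.tabulate f
    vertices-walkOf′ zero f adj = refl
    vertices-walkOf′ (suc L) f adj = cong (f zero ∷_) (vertices-walkOf′ L (f ∘ suc) (adj ∘ suc))

  walkOf : ∀ {L} → (P : Path G L) → Walk (start G P) (end G P)
  walkOf {L} P = walkOf′ L (Path.vtx P) (Path.adj P)

  vertices-walkOf : ∀ {L} (P : Path G L) → vertices (walkOf P) ≡ List.tabulate (Path.vtx P)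
  vertices-walkOf {L} P = vertices-walkOf′ L (Path.vtx P) (Path.adj P)

  length-walkOf : ∀ {L} (P : Path G L) → length (walkOf P) ≡ L
  length-walkOf {L} P = suc-injective (begin
    suc (length (walkOf P))                  ≡⟨ cong List.length (vertices-walkOf P) ⟩
    List.length (List.tabulate (Path.vtx P)) ≡⟨ Listₚ.length-tabulate (Path.vtx P) ⟩
    suc L                                    ∎)
    where open ≡-Reasoning

  walkOf-isPath : ∀ {L} (P : Path G L) → IsPath (walkOf P)
  walkOf-isPath P = subst Unique (sym (vertices-walkOf P)) (tabulate⁺ (λ {i} {j} → Path.inj P i j))

  ∈-walkOf : ∀ {L} (P : Path G L) {v} → v ∈ʷ walkOf P ⇔ OnP G P v
  ∈-walkOf P {v} = mk⇔
    (λ h → let i , v≡ = ∈-tabulate⁻ {f = Path.vtx P} (subst (v ∈_) (vertices-walkOf P) h) in i , sym v≡)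
    (λ { (i , refl) → subst (v ∈_) (sym (vertices-walkOf P)) (∈-tabulate⁺ {f = Path.vtx P} i) })

  pathIn : ∀ {L x y} (P : Path G L) → start G P ≡ x → end G P ≡ y → PathIn (OnP G P) x y
  pathIn P refl refl = record
    { walk = walkOf P ; isPath = walkOf-isPath P ; within = Equivalence.to (∈-walkOf P) }

  pathLength-pathIn : ∀ {L x y} (P : Path G L) (s : start G P ≡ x) (e : end G P ≡ y) →
                      pathLength (pathIn P s e) ≡ L
  pathLength-pathIn P refl refl = length-walkOf P

  private
    lookup-adj : (w : Walk a b) (i : Fin (length w)) →
                 Adj (List.lookup (vertices w) (inject₁ i)) (List.lookup (vertices w) (suc i))
    lookup-adj (e ◅ w) zero = e
    lookup-adj (e ◅ w) (suc i) = lookup-adj w i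

    lookup-end : (w : Walk a b) → List.lookup (vertices w) (fromℕ (length w)) ≡ b
    lookup-end [ _ ] = refl
    lookup-end (e ◅ w) = lookup-end w

  toPath : (w : Walk a b) → IsPath w → Path G (length w)
  toPath w w-path = record
    { vtx = List.lookup (vertices w) ; inj = lookup-injective w-path ; adj = lookup-adj w }

  HasCycleOfLength : ℕ → Set
  HasCycleOfLength n = Σ (Cycle G) λ C → cycleLength G C ≡ n

  toCycle : (W : Walk c c) → IsCycle W → 3 ≤ length W → HasCycleOfLength (length W)
  toCycle (e ◅ p@(_ ◅ _ ◅ q)) p-path _ =
    record { k = length q ; path = toPath p p-path ; close = subst (λ u → Adj u _) (sym (lookup-end p)) e } ,
    refl
  toCycle [ _ ] _ ()
  toCycle (_ ◅ [ _ ]) _ (s≤s ())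
  toCycle (_ ◅ _ ◅ [ _ ]) _ (s≤s (s≤s ()))

  module _ (C : Cycle G) where
    private
      P = Cycle.path C
      t = end G P

      closedWalk : Walk t t
      closedWalk = Cycle.close C ◅ walkOf P

    cycle-arcs : ∀ {c d} → OnC G C c → OnC G C d → c ≢ d →
                 Σ (PathIn (OnC G C) c d) λ A → Σ (PathIn (OnC G C) c d) λ A′ →
                 pathLength A + pathLength A′ ≡ cycleLength G C
    cycle-arcs c∈C d∈C c≢d
      with W , W↭C ← rotate closedWalk (Equivalence.from (∈-walkOf P) c∈C)
      with A , B , length≡ ← split-cycle W (Unique-resp-↭ (↭-sym W↭C) (walkOf-isPath P))
                                (∈-resp-↭ (↭-sym W↭C) (Equivalence.from (∈-walkOf P) d∈C)) c≢d =
      weaken on-C A , weaken on-C (reversePathIn B) , (begin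
        pathLength A + pathLength (reversePathIn B) ≡⟨ cong (pathLength A +_) (pathLength-reverse B) ⟩
        pathLength A + pathLength B                 ≡⟨ length≡ ⟩
        length W                                    ≡⟨ xs↭ys⇒|xs|≡|ys| W↭C ⟩
        length closedWalk                           ≡⟨ cong suc (length-walkOf P) ⟩
        cycleLength G C                             ∎)
      where
      open ≡-Reasoning
      on-C : ∀ {v} → v ∈ vertices⁺ W → OnC G C v
      on-C = Equivalence.to (∈-walkOf P) ∘ ∈-resp-↭ W↭C

  cycle-of-paths : ∀ {U U′ x y} → x ≢ y → (P : PathIn U x y) (Q : PathIn U′ x y) →
                   (∀ {v} → U v → U′ v → v ≡ x ⊎ v ≡ y) → 2 ≤ pathLength P →
                   HasCycleOfLength (pathLength P + pathLength Q)
  cycle-of-paths x≢y P Q meet 2≤P =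
    subst HasCycleOfLength length≡ (toCycle (walk P ◅◅ reverse (walk Q)) isCycle (subst (3 ≤_) (sym length≡) 3≤))
    where
    Q⁻ = reversePathIn Q
    disjoint : Disjoint (vertices⁺ (walk P)) (vertices⁺ (walk Q⁻))
    disjoint (h , h′) with meet (within P (there h)) (within Q⁻ (there h′))
    ... | inj₁ refl = start-∉ (walk P) (isPath P) h
    ... | inj₂ refl = start-∉ (walk Q⁻) (isPath Q⁻) h′
    isCycle : IsCycle (walk P ◅◅ walk Q⁻)
    isCycle = subst Unique (sym (vertices⁺-◅◅ (walk P) _)) (++⁺ (tail (isPath P)) (tail (isPath Q⁻)) disjoint)
    length≡ : length (walk P ◅◅ walk Q⁻) ≡ pathLength P + pathLength Q
    length≡ = trans (length-◅◅ (walk P) _) (cong (pathLength P +_) (pathLength-reverse Q))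
    3≤ : 3 ≤ pathLength P + pathLength Q
    3≤ = +-mono-≤ 2≤P (≢⇒0<length x≢y (walk Q))

  module _ {U₁ U₂ U₃ : V G → Set} {x y z : V G} where

    cycle-of-three-paths :
      x ≢ y → y ≢ z → z ≢ x → (P : PathIn U₁ x y) (Q : PathIn U₂ y z) (R : PathIn U₃ z x) →
      (∀ {v} → U₁ v → U₂ v → v ≡ y) → (∀ {v} → U₂ v → U₃ v → v ≡ z) → (∀ {v} → U₃ v → U₁ v → v ≡ x) →
      HasCycleOfLength (sum (pathLength P ∷ pathLength Q ∷ pathLength R ∷ []))
    cycle-of-three-paths x≢y y≢z z≢x P Q R meet₁₂ meet₂₃ meet₃₁ =
      subst HasCycleOfLength length≡
        (cycle-of-paths (z≢x ∘ sym) (join P Q meet₁₂) (reversePathIn R) meet (2≤pathLength-join P Q meet₁₂ x≢y y≢z))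
      where
      meet : ∀ {v} → (U₁ ∪ U₂) v → U₃ v → v ≡ x ⊎ v ≡ z
      meet (inj₁ u₁) u₃ = inj₁ (meet₃₁ u₃ u₁)
      meet (inj₂ u₂) u₃ = inj₂ (meet₂₃ u₂ u₃)
      length≡ : pathLength (join P Q meet₁₂) + pathLength (reversePathIn R) ≡
                sum (pathLength P ∷ pathLength Q ∷ pathLength R ∷ [])
      length≡ rewrite pathLength-join P Q meet₁₂ | pathLength-reverse R | +-identityʳ (pathLength R) =
        +-assoc (pathLength P) _ _

  module _ {U₁ U₂ U₃ U₄ : V G → Set} {x y z w : V G} where

    cycle-of-four-paths :
      x ≢ y → y ≢ z → x ≢ z →
      (P : PathIn U₁ x y) (Q : PathIn U₂ y z) (R : PathIn U₃ z w) (S : PathIn U₄ w x) →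
      (∀ {v} → U₁ v → U₂ v → v ≡ y) → (∀ {v} → U₂ v → U₃ v → v ≡ z) →
      (∀ {v} → U₃ v → U₄ v → v ≡ w) → (∀ {v} → U₄ v → U₁ v → v ≡ x) →
      (∀ {v} → U₁ v → U₃ v → ⊥) → (∀ {v} → U₂ v → U₄ v → ⊥) →
      HasCycleOfLength (sum (pathLength P ∷ pathLength Q ∷ pathLength R ∷ pathLength S ∷ []))
    cycle-of-four-paths x≢y y≢z x≢z P Q R S meet₁₂ meet₂₃ meet₃₄ meet₄₁ apart₁₃ apart₂₄ =
      subst HasCycleOfLength length≡
        (cycle-of-paths x≢z (join P Q meet₁₂) (reversePathIn (join R S meet₃₄)) meet
          (2≤pathLength-join P Q meet₁₂ x≢y y≢z))
      where
      meet : ∀ {v} → (U₁ ∪ U₂) v → (U₃ ∪ U₄) v → v ≡ x ⊎ v ≡ z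
      meet (inj₁ u₁) (inj₁ u₃) = ⊥-elim (apart₁₃ u₁ u₃)
      meet (inj₁ u₁) (inj₂ u₄) = inj₁ (meet₄₁ u₄ u₁)
      meet (inj₂ u₂) (inj₁ u₃) = inj₂ (meet₂₃ u₂ u₃)
      meet (inj₂ u₂) (inj₂ u₄) = ⊥-elim (apart₂₄ u₂ u₄)
      length≡ : pathLength (join P Q meet₁₂) + pathLength (reversePathIn (join R S meet₃₄)) ≡
                sum (pathLength P ∷ pathLength Q ∷ pathLength R ∷ pathLength S ∷ [])
      length≡ rewrite pathLength-reverse (join R S meet₃₄) | pathLength-join P Q meet₁₂ | pathLength-join R S meet₃₄
                    | +-identityʳ (pathLength S) = +-assoc (pathLength P) _ _

-- Cycles of length divisible by 4

module _ {G : Graph} where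
  open Walks G

  cycle4 : ∀ xss → All (HasCycleOfLength ∘ sum) xss → SomeDivisible xss → HasCycle4 G
  cycle4 xss cycles divisible with (C , length≡) , 4∣ ← lookupAny cycles divisible =
    C , subst (4 ∣_) (sym length≡) 4∣

  theta-cycle4 : ThetaE G → HasCycle4 G
  theta-cycle4 record { x = x ; y = y ; x≢y = x≢y ; P₁ = P₁ ; P₂ = P₂ ; P₃ = P₃
                      ; starts = s₁ , s₂ , s₃ ; ends = e₁ , e₂ , e₃ ; even = even₁ , even₂ , even₃
                      ; disj = disj₁₂ , disj₂₃ , disj₃₁ } =
    cycle4 (thetaSums _ _ _)
      (two-path-cycle P₁ P₂ s₁ e₁ s₂ e₂ disj₁₂ even₁ ∷ two-path-cycle P₂ P₃ s₂ e₂ s₃ e₃ disj₂₃ even₂ ∷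
       two-path-cycle P₃ P₁ s₃ e₃ s₁ e₁ disj₃₁ even₃ ∷ [])
      (theta-divisible even₁ even₂ even₃)
    where
    two-path-cycle : ∀ {l l′} (P : Path G l) (P′ : Path G l′) →
                     start G P ≡ x → end G P ≡ y → start G P′ ≡ x → end G P′ ≡ y →
                     IntDisjP G P P′ → Even l → HasCycleOfLength (sum (l ∷ l′ ∷ []))
    two-path-cycle {l} {l′} P P′ s e s′ e′ disjoint even =
      subst HasCycleOfLength lengths (cycle-of-paths x≢y Q Q′ meet 2≤|Q|)
      where
      Q = pathIn P s e
      Q′ = pathIn P′ s′ e′
      meet : ∀ {v} → OnP G P v → OnP G P′ v → v ≡ x ⊎ v ≡ y
      meet on on′ = Sum.map (λ v≡ → trans v≡ s) (λ v≡ → trans v≡ e) (proj₁ (disjoint _ on on′))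
      2≤|Q| : 2 ≤ pathLength Q
      2≤|Q| = even⇒2≤ (subst Even (sym (pathLength-pathIn P s e)) even) (≢⇒0<length x≢y (walk Q))
      lengths : pathLength Q + pathLength Q′ ≡ sum (l ∷ l′ ∷ [])
      lengths rewrite pathLength-pathIn P s e | pathLength-pathIn P′ s′ e′ | +-identityʳ l′ = refl

  record BothParities (U : V G → Set) (x y : V G) : Set where
    field
      evenPath : PathIn U x y
      even     : Even (pathLength evenPath)
      oddPath  : PathIn U x y
      odd      : Odd (pathLength oddPath)

  module _ {x y} (R : Adjustable G x y) where
    open Adjustable R

    private
      c₁≢c₂ : end G P₁ ≢ start G P₂
      c₁≢c₂ c₁≡c₂ = P₁P₂-disj _ (fromℕ l₁ , refl) (zero , sym c₁≡c₂)

      W₁ = pathIn P₁ P₁-x refl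
      W₂ = pathIn P₂ refl P₂-y

      meet₂ : ∀ {v} → OnC G C v → OnP G P₂ v → v ≡ start G P₂
      meet₂ on-C on-P₂ = P₂-only _ on-P₂ on-C

      meet₁ : ∀ {v} → OnP G P₁ v → (OnC G C ∪ OnP G P₂) v → v ≡ end G P₁
      meet₁ on-P₁ (inj₁ on-C) = P₁-only _ on-P₁ on-C
      meet₁ on-P₁ (inj₂ on-P₂) = ⊥-elim (P₁P₂-disj _ on-P₁ on-P₂)

      on-R : ∀ {v} → (OnP G P₁ ∪ (OnC G C ∪ OnP G P₂)) v → OnA G R v
      on-R (inj₁ on-P₁) = inj₂ (inj₁ on-P₁)
      on-R (inj₂ (inj₁ on-C)) = inj₁ on-C
      on-R (inj₂ (inj₂ on-P₂)) = inj₂ (inj₂ on-P₂)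

      via : PathIn (OnC G C) (end G P₁) (start G P₂) → PathIn (OnA G R) x y
      via A = weaken on-R (join W₁ (join A W₂ meet₂) meet₁)

      pathLength-via : ∀ A → pathLength (via A) ≡ l₁ + (pathLength A + l₂)
      pathLength-via A
        rewrite pathLength-join W₁ (join A W₂ meet₂) meet₁ | pathLength-join A W₂ meet₂
              | pathLength-pathIn P₁ P₁-x refl | pathLength-pathIn P₂ refl P₂-y = refl

    -- Abstract, so that comparing lengths of its paths never unfolds the construction.
    abstract
      adjustable-paths : BothParities (OnA G R) x y
      adjustable-paths with A , A′ , arcs ← cycle-arcs C P₁-C P₂-C c₁≢c₂
        with odd-+-parities (subst₂ (λ m n → Odd (m + n)) (sym (pathLength-via A)) (sym (pathLength-via A′))
                              (odd-+-shift l₁ l₂ (subst Odd (sym arcs) C-odd)))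
      ... | inj₁ (even , odd) = record { evenPath = via A ; even = even ; oddPath = via A′ ; odd = odd }
      ... | inj₂ (odd , even) = record { evenPath = via A′ ; even = even ; oddPath = via A ; odd = odd }

  necklace-cycle4 : OddNecklace G → HasCycle4 G
  necklace-cycle4 N =
    cycle4 (necklaceSums (pathLength E₁) (pathLength O₁) (pathLength E₂) (pathLength O₂) (pathLength E₃) (pathLength O₃))
      (cycle E₁ E₂ E₃ ∷ cycle E₁ O₂ O₃ ∷ cycle O₁ E₂ O₃ ∷ cycle O₁ O₂ E₃ ∷ [])
      (necklace-divisible even₁ odd₁ even₂ odd₂ even₃ odd₃)
    where
    open OddNecklace N
    open BothParities (adjustable-paths R₁) renaming (evenPath to E₁; even to even₁; oddPath to O₁; odd to odd₁)
    open BothParities (adjustable-paths R₂) renaming (evenPath to E₂; even to even₂; oddPath to O₂; odd to odd₂)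
    open BothParities (adjustable-paths R₃) renaming (evenPath to E₃; even to even₃; oddPath to O₃; odd to odd₃)
    cycle : (S₁ : PathIn (OnA G R₁) x₁ x₂) (S₂ : PathIn (OnA G R₂) x₂ x₃) (S₃ : PathIn (OnA G R₃) x₃ x₁) →
            HasCycleOfLength (sum (pathLength S₁ ∷ pathLength S₂ ∷ pathLength S₃ ∷ []))
    cycle S₁ S₂ S₃ = cycle-of-three-paths (proj₁ distinct) (proj₁ (proj₂ distinct)) (proj₂ (proj₂ distinct))
                       S₁ S₂ S₃ (disj₁₂ _) (disj₂₃ _) (disj₃₁ _)

  module _ (S : K4Subdivision G) where
    open K4Subdivision S

    branch : ∀ {e p q} → Joins e p q → PathIn (OnP G (P e)) (b p) (b q)
    branch {e} (inj₁ (refl , refl)) = pathIn (P e) (P-start e) (P-end e)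
    branch {e} (inj₂ (refl , refl)) = reversePathIn (pathIn (P e) (P-start e) (P-end e))

    pathLength-branch : ∀ {e p q} (j : Joins e p q) → pathLength (branch j) ≡ len e
    pathLength-branch {e} (inj₁ (refl , refl)) = pathLength-pathIn (P e) (P-start e) (P-end e)
    pathLength-branch {e} (inj₂ (refl , refl)) =
      trans (pathLength-reverse (pathIn (P e) (P-start e) (P-end e))) (pathLength-pathIn (P e) (P-start e) (P-end e))

    b-≢ : ∀ {p q} → p ≢ q → b p ≢ b q
    b-≢ p≢q = p≢q ∘ b-inj _ _

    private
      end-label : ∀ {e v} → IsEndP G (P e) v → ∃ λ t → v ≡ b t × IsEnd e t
      end-label {e} (inj₁ v≡) = K4src e , trans v≡ (P-start e) , inj₁ refl
      end-label {e} (inj₂ v≡) = K4tgt e , trans v≡ (P-end e) , inj₂ refl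

    branches-meet : ∀ {e e′ v} → e ≢ e′ → OnP G (P e) v → OnP G (P e′) v →
                    ∃ λ t → v ≡ b t × IsEnd e t × IsEnd e′ t
    branches-meet {e} {e′} e≢e′ on on′
      with end , end′ ← disj e e′ e≢e′ _ on on′
      with t , v≡bt , t-end ← end-label end | t′ , v≡bt′ , t′-end ← end-label end′ =
      t , v≡bt , t-end , subst (IsEnd e′) (b-inj t′ t (trans (sym v≡bt′) v≡bt)) t′-end

    consecutive-meet : ∀ {e e′ p q r v} → Joins e p q → Joins e′ q r → p ≢ q → p ≢ r →
                       OnP G (P e) v → OnP G (P e′) v → v ≡ b q
    consecutive-meet {p = p} {q} {r} j j′ p≢q p≢r on on′
      with t , refl , t-end , t-end′ ← branches-meet (joins-≢ j j′ p≢q p≢r) on on′ =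
      cong b (shared (joins-ends j t-end) (joins-ends j′ t-end′))
      where
      shared : ∀ {t} → t ≡ p ⊎ t ≡ q → t ≡ q ⊎ t ≡ r → t ≡ q
      shared (inj₂ t≡q) _ = t≡q
      shared (inj₁ _) (inj₁ t≡q) = t≡q
      shared (inj₁ refl) (inj₂ refl) = ⊥-elim (p≢r refl)

    apart : ∀ {e e′ p q r s v} → Joins e p q → Joins e′ r s → p ≢ r → p ≢ s → q ≢ r → q ≢ s →
            OnP G (P e) v → OnP G (P e′) v → ⊥
    apart j j′ p≢r p≢s q≢r q≢s on on′
      with _ , _ , t-end , t-end′ ← branches-meet (joins-≢ j j′ p≢r p≢s) on on′
      with joins-ends j t-end | joins-ends j′ t-end′
    ... | inj₁ refl | inj₁ refl = p≢r refl
    ... | inj₁ refl | inj₂ refl = p≢s refl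
    ... | inj₂ refl | inj₁ refl = q≢r refl
    ... | inj₂ refl | inj₂ refl = q≢s refl

    triangle : ∀ {e₁ e₂ e₃ p q r} → Joins e₁ p q → Joins e₂ q r → Joins e₃ r p → p ≢ q → q ≢ r → r ≢ p →
               HasCycleOfLength (sum (len e₁ ∷ len e₂ ∷ len e₃ ∷ []))
    triangle j₁ j₂ j₃ p≢q q≢r r≢p
      rewrite sym (pathLength-branch j₁) | sym (pathLength-branch j₂) | sym (pathLength-branch j₃) =
        cycle-of-three-paths (b-≢ p≢q) (b-≢ q≢r) (b-≢ r≢p) (branch j₁) (branch j₂) (branch j₃)
          (consecutive-meet j₁ j₂ p≢q (r≢p ∘ sym)) (consecutive-meet j₂ j₃ q≢r (p≢q ∘ sym))
          (consecutive-meet j₃ j₁ r≢p (q≢r ∘ sym))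

    square : ∀ {e₁ e₂ e₃ e₄ p q r s} → Joins e₁ p q → Joins e₂ q r → Joins e₃ r s → Joins e₄ s p →
             p ≢ q → q ≢ r → r ≢ s → s ≢ p → p ≢ r → q ≢ s →
             HasCycleOfLength (sum (len e₁ ∷ len e₂ ∷ len e₃ ∷ len e₄ ∷ []))
    square j₁ j₂ j₃ j₄ p≢q q≢r r≢s s≢p p≢r q≢s
      rewrite sym (pathLength-branch j₁) | sym (pathLength-branch j₂)
            | sym (pathLength-branch j₃) | sym (pathLength-branch j₄) =
        cycle-of-four-paths (b-≢ p≢q) (b-≢ q≢r) (b-≢ p≢r) (branch j₁) (branch j₂) (branch j₃) (branch j₄)
          (consecutive-meet j₁ j₂ p≢q p≢r) (consecutive-meet j₂ j₃ q≢r q≢s)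
          (consecutive-meet j₃ j₄ r≢s (p≢r ∘ sym)) (consecutive-meet j₄ j₁ s≢p (q≢s ∘ sym))
          (apart j₁ j₃ p≢r (s≢p ∘ sym) q≢r q≢s) (apart j₂ j₄ q≢s (p≢q ∘ sym) r≢s (p≢r ∘ sym))

  module _ (S : K4Subdivision G) (F : K4Frame) where
    open K4Subdivision S using (len)
    open K4Frame F

    frameSums : List (List ℕ)
    frameSums = k4Sums (len ab) (len ac) (len ad) (len bc) (len bd) (len cd)

    frame-cycles : All (HasCycleOfLength ∘ sum) frameSums
    frame-cycles =
      triangle S ab-joins bc-joins (joins-sym ac-joins) a≢b b≢c (a≢c ∘ sym) ∷
      triangle S ab-joins bd-joins (joins-sym ad-joins) a≢b b≢d (a≢d ∘ sym) ∷
      triangle S ac-joins cd-joins (joins-sym ad-joins) a≢c c≢d (a≢d ∘ sym) ∷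
      triangle S bc-joins cd-joins (joins-sym bd-joins) b≢c c≢d (b≢d ∘ sym) ∷
      square S ab-joins bc-joins cd-joins (joins-sym ad-joins) a≢b b≢c c≢d (a≢d ∘ sym) a≢c b≢d ∷
      square S ab-joins bd-joins (joins-sym cd-joins) (joins-sym ac-joins) a≢b b≢d (c≢d ∘ sym) (a≢c ∘ sym) a≢d b≢c ∷
      square S ac-joins (joins-sym bc-joins) bd-joins (joins-sym ad-joins) a≢c (b≢c ∘ sym) b≢d (a≢d ∘ sym) a≢b c≢d ∷
      []

  h3e-cycle4 : H3e G → HasCycle4 G
  h3e-cycle4 (S , Z , even-on-Z) =
    cycle4 (frameSums S F) (frame-cycles S F)
      (k4-even-triangle (even-on-Z _ (zero , ab-joins)) (even-on-Z _ (suc zero , bc-joins))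
                        (even-on-Z _ (suc (suc zero) , joins-sym ac-joins)))
    where
    F = triangleFrame Z
    open K4Frame F using (ab-joins; bc-joins; ac-joins)

  h4-cycle4 : ∀ {Par} → (∀ {ab ac ad bc bd cd} → Par ab → Par bc → Par cd → Par ad → SomeDivisible (k4Sums ab ac ad bc bd cd)) →
              H G 4 Par → HasCycle4 G
  h4-cycle4 divisible (S , Z , par-on-Z) =
    cycle4 (frameSums S F) (frame-cycles S F)
      (divisible (par-on-Z _ (zero , ab-joins)) (par-on-Z _ (suc zero , bc-joins))
                 (par-on-Z _ (suc (suc zero) , cd-joins)) (par-on-Z _ (suc (suc (suc zero)) , joins-sym ad-joins)))
    where
    F = squareFrame Z
    open K4Frame F using (ab-joins; bc-joins; cd-joins; ad-joins)

lemma1 : (G : Graph)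
       → (ThetaE G → HasCycle4 G)
       × (OddNecklace G → HasCycle4 G)
       × (H3e G ⊎ H4o G ⊎ H4e G → HasCycle4 G)
lemma1 G = theta-cycle4 , necklace-cycle4 , Sum.[ h3e-cycle4 , Sum.[ h4-cycle4 k4-odd-square , h4-cycle4 k4-even-square ] ]
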